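{- There exist exponentially many cubefree binary squares of length $n$; that is, there is a real constant $c>1$ such that for infinitely many positive integers $n$, the number of distinct cubefree words over $\{0,1\}$ of length $n$ that are squares is at least $c^n$.
   Context: A square is a non-empty word of the form $xx$; a cube is a non-empty word of the form $xxx$. A word is cubefree if none of its factors (contiguous subwords) is a cube. -}

module Defs where

open import Data.Bool using (Bool)
open import Data.Nat using (ℕ)
open import Data.List using (List; []; _++_; length)
open import Data.Product using (Σ; ∃; _×_)
open import Relation.Binary.PropositionalEquality using (_≡_; _≢_)
open import Relation.Nullary using (¬_)

Word : Set
Word = List Bool

Factor : Word → Word → Set
Factor u w = ∃ λ x → ∃ λ y → x ++ u ++ y ≡ w

Square : Word → Set
Square w = ∃ λ x → x ≢ [] × w ≡ x ++ x

Cube : Word → Set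
Cube w = ∃ λ x → x ≢ [] × w ≡ x ++ x ++ x

Cubefree : Word → Set
Cubefree w = ∀ u → Factor u w → ¬ Cube u

CubefreeSquareOfLength : ℕ → Word → Set
CubefreeSquareOfLength n w = length w ≡ n × Square w × Cubefree w

-- The proof uses a 12-uniform morphism μ from the alphabet Sym = {0,1}² to {0,1}:
-- the block μ(a , c) begins with a, and the "choice" c can be read back from it.
-- The core fact (morph-preserves-cubefree) is that μ maps every word u of at least
-- four letters whose underlying binary word (first components) is cubefree to a
-- cubefree word.  A cube of period p in μ(u) is ruled out in three cases:
--   p < 12   it lies in the image of four letters; a finite check (short-period),
--   12 ∣ p   it is the image of a cube in the letters of u (aligned-pullback),
--   else     a block would match another block shifted by 1..11 positions, which
--            a second finite check excludes (unaligned-impossible).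
--
-- Iterating μ from Y₀ = 001 gives arbitrarily long Y with YY cubefree (seed).  For each
-- such Y and each c ∈ {0,1}^|Y|, μ(zip Y c)² is a cubefree square of length 24|Y|, and
-- these 2^|Y| squares are distinct (cubefree-squares).  Since 2·35²⁴ ≥ 36²⁴, there are
-- at least (36/35)ⁿ of them for n = 24|Y|, which is the theorem with c = 36/35.

module Submission where

open import Data.Bool using (Bool; true; false; _∧_; _∨_; not; T)
open import Data.Bool.Properties using (T-∧; T-∨)
open import Data.Empty using (⊥)
open import Data.Unit using (tt)
open import Data.Nat using (ℕ; zero; suc; _+_; _*_; _∸_; _^_; _≤?_; _≤_; _<_; _≤ᵇ_; z≤n; s≤s; z<s; _<?_)
open import Data.Nat.Properties
open import Data.Nat.DivMod using (_/_; _%_; m≡m%n+[m/n]*n; m%n<n)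
open import Data.Nat.Tactic.RingSolver using (solve-∀)
open import Data.List using (List; []; _∷_; _++_; length; map; take; drop; zip; replicate)
open import Data.List.Properties using (++-assoc; length-++; map-++; length-map; ∷-injectiveʳ; take++drop≡id; length-take; length-drop; length-replicate)
open import Data.List.Membership.Propositional using (_∈_)
open import Data.List.Membership.Propositional.Properties using (∈-map⁻)
open import Data.List.Relation.Unary.All using (All; []; _∷_)
import Data.List.Relation.Unary.All as All
import Data.List.Relation.Unary.All.Properties as All
open import Data.List.Relation.Unary.AllPairs using ([]; _∷_)
open import Data.List.Relation.Unary.Unique.Propositional using (Unique)
import Data.List.Relation.Unary.Unique.Propositional.Properties as Unique
open import Data.Product using (∃; _×_; _,_; proj₁; proj₂)
open import Data.Sum using (_⊎_; inj₁; inj₂)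
open import Function.Bundles using (Equivalence)
open import Relation.Binary.PropositionalEquality
open import Relation.Nullary using (¬_; yes; no; contradiction)
open import Defs

open Equivalence using (to; from)

pattern O = false
pattern I = true

-- The t-th letter of a word (counting from 0), and O past its end.  Describing
-- cubes by positions turns all periodicity arguments into arithmetic.
at : Word → ℕ → Bool
at []       _       = O
at (x ∷ xs) zero    = x
at (x ∷ xs) (suc t) = at xs t

at-++ʳ : ∀ xs ys t → at (xs ++ ys) (length xs + t) ≡ at ys t
at-++ʳ []       ys t = refl
at-++ʳ (x ∷ xs) ys t = at-++ʳ xs ys t

at-++ˡ : ∀ xs ys {t} → t < length xs → at (xs ++ ys) t ≡ at xs t
at-++ˡ (x ∷ xs) ys {zero}  _         = refl
at-++ˡ (x ∷ xs) ys {suc t} (s≤s t<n) = at-++ˡ xs ys t<n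

at-mid : ∀ xs ys zs {t} → t < length ys → at (xs ++ ys ++ zs) (length xs + t) ≡ at ys t
at-mid xs ys zs {t} t<n = trans (at-++ʳ xs (ys ++ zs) t) (at-++ˡ ys zs t<n)

at-drop : ∀ n xs t → at (drop n xs) t ≡ at xs (n + t)
at-drop zero    xs       t = refl
at-drop (suc n) []       t = refl
at-drop (suc n) (x ∷ xs) t = at-drop n xs t

record CubeAt (w : Word) (i p : ℕ) : Set where
  constructor cube
  field
    period>0 : 0 < p
    fits     : i + (p + (p + p)) ≤ length w
    periodic : ∀ t → t < p + p → at w (i + t) ≡ at w (i + p + t)

NoCubeAt : Word → Set
NoCubeAt w = ∀ i p → ¬ CubeAt w i p

cube-inside : ∀ {i p n t} → i + (p + (p + p)) ≤ n → t < p + p → i + t < n × i + p + t < n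
cube-inside {i} {p} {n} {t} fits t<2p = first , second
  where
  first : i + t < n
  first = <-≤-trans (+-monoʳ-< i (<-≤-trans t<2p (m≤m+n (p + p) p)))
                    (≤-trans (≤-reflexive (cong (i +_) (+-assoc p p p))) fits)
  second : i + p + t < n
  second = <-≤-trans (+-monoʳ-< (i + p) t<2p) (≤-trans (≤-reflexive (+-assoc i p (p + p))) fits)

at-zzz : ∀ z y {t} → t < length z + length z → at (z ++ z ++ z ++ y) t ≡ at (z ++ z ++ y) t
at-zzz z y {t} t<2z with t <? length z
... | yes t<z = trans (at-++ˡ z _ t<z) (sym (at-++ˡ z _ t<z))
... | no  t≮z with m≤n⇒∃[o]m+o≡n (≮⇒≥ t≮z)
... | t' , refl = begin
  at (z ++ z ++ z ++ y) (length z + t') ≡⟨ at-++ʳ z _ t' ⟩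
  at (z ++ z ++ y) t'                   ≡⟨ at-++ˡ z _ t'<z ⟩
  at z t'                               ≡⟨ sym (at-++ˡ z _ t'<z) ⟩
  at (z ++ y) t'                        ≡⟨ sym (at-++ʳ z _ t') ⟩
  at (z ++ z ++ y) (length z + t')      ∎
  where
  open ≡-Reasoning
  t'<z : t' < length z
  t'<z = +-cancelˡ-< (length z) t' (length z) t<2z

nonempty : ∀ (z : Word) → z ≢ [] → 0 < length z
nonempty []      z≢[] = contradiction refl z≢[]
nonempty (_ ∷ _) _    = z<s

cubeAt-factor : ∀ x z y → z ≢ [] → CubeAt (x ++ z ++ z ++ z ++ y) (length x) (length z)
cubeAt-factor x z y z≢[] = cube (nonempty z z≢[]) fits periodic
  where
  open ≡-Reasoning
  w : Word
  w = x ++ z ++ z ++ z ++ y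
  l : ℕ
  l = length z
  zzz≤ : l + (l + l) ≤ length (z ++ z ++ z ++ y)
  zzz≤ = subst (l + (l + l) ≤_)
           (sym (trans (length-++ z) (cong (l +_) (trans (length-++ z) (cong (l +_) (length-++ z))))))
           (+-monoʳ-≤ l (+-monoʳ-≤ l (m≤m+n l (length y))))
  fits : length x + (l + (l + l)) ≤ length w
  fits = subst (length x + (l + (l + l)) ≤_) (sym (length-++ x)) (+-monoʳ-≤ (length x) zzz≤)
  periodic : ∀ t → t < l + l → at w (length x + t) ≡ at w (length x + l + t)
  periodic t t<2l = begin
    at w (length x + t)                    ≡⟨ at-++ʳ x _ t ⟩
    at (z ++ z ++ z ++ y) t                ≡⟨ at-zzz z y t<2l ⟩
    at (z ++ z ++ y) t                     ≡⟨ sym (at-++ʳ z _ t) ⟩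
    at (z ++ z ++ z ++ y) (l + t)          ≡⟨ sym (at-++ʳ x _ (l + t)) ⟩
    at w (length x + (l + t))              ≡⟨ cong (at w) (sym (+-assoc (length x) l t)) ⟩
    at w (length x + l + t)                ∎

cubefree : ∀ {w} → NoCubeAt w → Cubefree w
cubefree {w} noCube u (x , y , x++u++y≡w) (z , z≢[] , u≡zzz) =
  noCube (length x) (length z) (subst (λ v → CubeAt v (length x) (length z)) w≡ (cubeAt-factor x z y z≢[]))
  where
  open ≡-Reasoning
  w≡ : x ++ z ++ z ++ z ++ y ≡ w
  w≡ = begin
    x ++ z ++ z ++ z ++ y   ≡⟨ cong (x ++_) (sym (trans (++-assoc z (z ++ z) y) (cong (z ++_) (++-assoc z z y)))) ⟩
    x ++ (z ++ z ++ z) ++ y ≡⟨ cong (λ v → x ++ v ++ y) (sym u≡zzz) ⟩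
    x ++ u ++ y             ≡⟨ x++u++y≡w ⟩
    w                       ∎

at-window : ∀ a v b k t → k + t < length v → at (a ++ v ++ b) (length a + k + t) ≡ at v (k + t)
at-window a v b k t k+t<v = trans (cong (at (a ++ v ++ b)) (+-assoc (length a) k t)) (at-mid a v b k+t<v)

at-window₂ : ∀ a v b k p t → k + p + t < length v → at (a ++ v ++ b) (length a + k + p + t) ≡ at v (k + p + t)
at-window₂ a v b k p t h = trans (cong (λ s → at (a ++ v ++ b) (s + t)) (+-assoc (length a) k p)) (at-window a v b (k + p) t h)

cubeAt-extend : ∀ a v b {i p} → CubeAt v i p → CubeAt (a ++ v ++ b) (length a + i) p
cubeAt-extend a v b {i} {p} (cube p>0 fits periodic) = cube p>0 fits' periodic'
  where
  fits' : length a + i + (p + (p + p)) ≤ length (a ++ v ++ b)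
  fits' = subst₂ _≤_ (sym (+-assoc (length a) i _)) (sym (trans (length-++ a) (cong (length a +_) (length-++ v))))
            (+-monoʳ-≤ (length a) (≤-trans fits (m≤m+n (length v) (length b))))
  periodic' : ∀ t → t < p + p → at (a ++ v ++ b) (length a + i + t) ≡ at (a ++ v ++ b) (length a + i + p + t)
  periodic' t t<2p with cube-inside fits t<2p
  ... | in₁ , in₂ = trans (at-window a v b i t in₁) (trans (periodic t t<2p) (sym (at-window₂ a v b i p t in₂)))

cubeAt-restrict : ∀ a v b {i p} → i + (p + (p + p)) ≤ length v → CubeAt (a ++ v ++ b) (length a + i) p → CubeAt v i p
cubeAt-restrict a v b {i} {p} fits (cube p>0 _ periodic) = cube p>0 fits periodic'
  where
  periodic' : ∀ t → t < p + p → at v (i + t) ≡ at v (i + p + t)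
  periodic' t t<2p with cube-inside fits t<2p
  ... | in₁ , in₂ = trans (sym (at-window a v b i t in₁)) (trans (periodic t t<2p) (at-window₂ a v b i p t in₂))

anyBelow : ℕ → (ℕ → Bool) → Bool
anyBelow zero    f = false
anyBelow (suc n) f = f n ∨ anyBelow n f

allBelow : ℕ → (ℕ → Bool) → Bool
allBelow zero    f = true
allBelow (suc n) f = f n ∧ allBelow n f

anyBelow-sound : ∀ n f → T (anyBelow n f) → ∃ λ t → t < n × T (f t)
anyBelow-sound (suc n) f h with to T-∨ h
... | inj₁ fn  = n , ≤-refl , fn
... | inj₂ any with anyBelow-sound n f any
...   | t , t<n , ft = t , m<n⇒m<1+n t<n , ft

anyBelow-complete : ∀ n f {t} → t < n → T (f t) → T (anyBelow n f)
anyBelow-complete (suc n) f {t} t<1+n ft with m<1+n⇒m<n∨m≡n t<1+n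
... | inj₁ t<n  = from T-∨ (inj₂ (anyBelow-complete n f t<n ft))
... | inj₂ refl = from T-∨ (inj₁ ft)

allBelow-sound : ∀ n f → T (allBelow n f) → ∀ t → t < n → T (f t)
allBelow-sound (suc n) f h t t<1+n with to T-∧ h | m<1+n⇒m<n∨m≡n t<1+n
... | _  , all | inj₁ t<n  = allBelow-sound n f all t t<n
... | fn , _   | inj₂ refl = fn

eqb : Bool → Bool → Bool
eqb I I = I
eqb O O = I
eqb _ _ = O

eqb-sound : ∀ {a b} → T (eqb a b) → a ≡ b
eqb-sound {I} {I} _ = refl
eqb-sound {O} {O} _ = refl

eqb-refl : ∀ a → T (eqb a a)
eqb-refl I = tt
eqb-refl O = tt

agree : ℕ → Word → Word → Bool
agree zero    xs ys = true
agree (suc n) xs ys = eqb (at xs 0) (at ys 0) ∧ agree n (drop 1 xs) (drop 1 ys)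

agree-sound : ∀ n xs ys → T (agree n xs ys) → ∀ t → t < n → at xs t ≡ at ys t
agree-sound (suc n) xs ys h zero    _         = eqb-sound (proj₁ (to T-∧ h))
agree-sound (suc n) xs ys h (suc t) (s≤s t<n) =
  trans (sym (at-drop 1 xs t)) (trans (agree-sound n (drop 1 xs) (drop 1 ys) (proj₂ (to T-∧ h)) t t<n) (at-drop 1 ys t))

agree-complete : ∀ n xs ys → (∀ t → t < n → at xs t ≡ at ys t) → T (agree n xs ys)
agree-complete zero    xs ys same = tt
agree-complete (suc n) xs ys same = from T-∧
  ( subst (λ b → T (eqb (at xs 0) b)) (same 0 z<s) (eqb-refl (at xs 0))
  , agree-complete n (drop 1 xs) (drop 1 ys)
      (λ t t<n → trans (at-drop 1 xs t) (trans (same (suc t) (s≤s t<n)) (sym (at-drop 1 ys t)))))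

cubeAtStart : Word → ℕ → Bool
cubeAtStart w zero    = false
cubeAtStart w (suc q) = agree (suc q + suc q) w (drop (suc q) w) ∧ (suc q + (suc q + suc q) ≤ᵇ length w)

cubeAtStart-sound : ∀ w p → T (cubeAtStart w p) → CubeAt w 0 p
cubeAtStart-sound w (suc q) h with to T-∧ h
... | same , long = cube z<s (≤ᵇ⇒≤ _ _ long)
  λ t t<2p → trans (agree-sound _ w (drop (suc q) w) same t t<2p) (at-drop (suc q) w t)

cubeAtStart-complete : ∀ w p → CubeAt w 0 p → T (cubeAtStart w p)
cubeAtStart-complete w (suc q) (cube _ fits periodic) = from T-∧
  ( agree-complete _ w (drop (suc q) w) (λ t t<2p → trans (periodic t t<2p) (sym (at-drop (suc q) w t)))
  , ≤⇒≤ᵇ fits )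

hasShortCube : ℕ → Word → Bool
hasShortCube P []           = false
hasShortCube P w@(_ ∷ rest) = anyBelow P (cubeAtStart w) ∨ hasShortCube P rest

hasShortCube-sound : ∀ P w → T (hasShortCube P w) → ∃ λ i → ∃ λ p → CubeAt w i p
hasShortCube-sound P w@(x ∷ rest) h with to T-∨ h
... | inj₁ here with anyBelow-sound P (cubeAtStart w) here
...   | p , _ , start = 0 , p , cubeAtStart-sound w p start
hasShortCube-sound P w@(x ∷ rest) h | inj₂ later with hasShortCube-sound P rest later
...   | i , p , cube p>0 fits periodic = suc i , p , cube p>0 (s≤s fits) periodic

hasShortCube-complete : ∀ P w {i p} → CubeAt w i p → p < P → T (hasShortCube P w)
hasShortCube-complete P [] {i} {suc q} (cube _ fits _) p<P
  with () ← ≤-trans (m≤n+m (suc q + (suc q + suc q)) i) fits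
hasShortCube-complete P w@(x ∷ rest) {zero} {p} c p<P =
  from T-∨ (inj₁ (anyBelow-complete P (cubeAtStart w) p<P (cubeAtStart-complete w p c)))
hasShortCube-complete P w@(x ∷ rest) {suc i} (cube p>0 (s≤s fits) periodic) p<P =
  from T-∨ (inj₂ (hasShortCube-complete P rest (cube p>0 fits periodic) p<P))

shortPeriodsExcluded : ∀ P w → ¬ T (hasShortCube P w) → ∀ {i p} → CubeAt w i p → P ≤ p
shortPeriodsExcluded P w none {p = p} c with p <? P
... | yes p<P = contradiction (hasShortCube-complete P w c p<P) none
... | no  p≮P = ≮⇒≥ p≮P

-- The four-letter alphabet {0,1}²: a letter (a , c) carries a binary letter a
-- together with a free binary choice c.
Sym : Set
Sym = Bool × Bool

block : Bool → Bool → Word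
block O O = O ∷ I ∷ O ∷ I ∷ I ∷ O ∷ I ∷ I ∷ O ∷ O ∷ I ∷ O ∷ []
block O I = O ∷ I ∷ O ∷ I ∷ O ∷ O ∷ I ∷ O ∷ O ∷ I ∷ I ∷ O ∷ []
block I O = I ∷ I ∷ O ∷ I ∷ O ∷ I ∷ I ∷ O ∷ O ∷ I ∷ I ∷ O ∷ []
block I I = I ∷ O ∷ O ∷ I ∷ I ∷ O ∷ I ∷ I ∷ O ∷ O ∷ I ∷ O ∷ []

morph : List Sym → Word
morph []            = []
morph ((a , c) ∷ u) = block a c ++ morph u

letters : List Sym → Word
letters = map proj₁

block-length : ∀ a c → length (block a c) ≡ 12
block-length O O = refl
block-length O I = refl
block-length I O = refl
block-length I I = refl

block-head : ∀ a c R → at (block a c ++ R) 0 ≡ a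
block-head O O R = refl
block-head O I R = refl
block-head I O R = refl
block-head I I R = refl

morph-++ : ∀ u v → morph (u ++ v) ≡ morph u ++ morph v
morph-++ []            v = refl
morph-++ ((a , c) ∷ u) v = trans (cong (block a c ++_) (morph-++ u v)) (sym (++-assoc (block a c) (morph u) (morph v)))

morph-length : ∀ u → length (morph u) ≡ length u * 12
morph-length []            = refl
morph-length ((a , c) ∷ u) = trans (length-++ (block a c)) (cong₂ _+_ (block-length a c) (morph-length u))

morph-at-block : ∀ u {k} → k < length u → at (morph u) (k * 12) ≡ at (letters u) k
morph-at-block ((a , c) ∷ u) {zero}  _         = block-head a c (morph u)
morph-at-block ((a , c) ∷ u) {suc k} (s≤s k<n) = begin
  at (block a c ++ morph u) (12 + k * 12)                    ≡⟨ cong (λ l → at (block a c ++ morph u) (l + k * 12)) (sym (block-length a c)) ⟩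
  at (block a c ++ morph u) (length (block a c) + k * 12)    ≡⟨ at-++ʳ (block a c) (morph u) (k * 12) ⟩
  at (morph u) (k * 12)                                      ≡⟨ morph-at-block u k<n ⟩
  at (letters u) k                                           ∎
  where open ≡-Reasoning

morph-window : ∀ u a v b → u ≡ a ++ v ++ b → ∀ {x} → x < length v * 12 →
               at (morph u) (length a * 12 + x) ≡ at (morph v) x
morph-window u a v b refl {x} x<v = begin
  at (morph (a ++ v ++ b)) (length a * 12 + x)                ≡⟨ cong₂ at (trans (morph-++ a (v ++ b)) (cong (morph a ++_) (morph-++ v b)))
                                                                              (cong (_+ x) (sym (morph-length a))) ⟩
  at (morph a ++ morph v ++ morph b) (length (morph a) + x)   ≡⟨ at-mid (morph a) (morph v) (morph b) (subst (x <_) (sym (morph-length v)) x<v) ⟩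
  at (morph v) x                                              ∎
  where open ≡-Reasoning

split3 : ∀ {A : Set} (u : List A) k j → k + j ≤ length u →
         ∃ λ a → ∃ λ v → ∃ λ b → u ≡ a ++ v ++ b × length a ≡ k × length v ≡ j
split3 u k j k+j≤u = take k u , take j (drop k u) , drop j (drop k u) , split , length-a , length-v
  where
  split : u ≡ take k u ++ take j (drop k u) ++ drop j (drop k u)
  split = sym (trans (cong (take k u ++_) (take++drop≡id j (drop k u))) (take++drop≡id k u))
  length-a : length (take k u) ≡ k
  length-a = trans (length-take k u) (m≤n⇒m⊓n≡m (≤-trans (m≤m+n k j) k+j≤u))
  j≤rest : j ≤ length (drop k u)
  j≤rest = subst (j ≤_) (sym (length-drop k u)) (m+n≤o⇒m≤o∸n j (subst (_≤ length u) (+-comm k j) k+j≤u))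
  length-v : length (take j (drop k u)) ≡ j
  length-v = trans (length-take j (drop k u)) (m≤n⇒m⊓n≡m j≤rest)

forAllSym : (Sym → Bool) → Bool
forAllSym g = g (O , O) ∧ g (O , I) ∧ g (I , O) ∧ g (I , I)

forAllWords : ℕ → (List Sym → Bool) → Bool
forAllWords zero    f = f []
forAllWords (suc n) f = forAllSym λ s → forAllWords n λ u → f (s ∷ u)

forAllSym-elim : ∀ g → T (forAllSym g) → ∀ s → T (g s)
forAllSym-elim g h s with to (T-∧ {g (O , O)}) h
... | oo , h₁ with to (T-∧ {g (O , I)}) h₁
...   | oi , h₂ with to (T-∧ {g (I , O)}) h₂ | s
...     | _  , _  | (O , O) = oo
...     | _  , _  | (O , I) = oi
...     | io , _  | (I , O) = io
...     | _  , ii | (I , I) = ii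

forAllWords-elim : ∀ n f → T (forAllWords n f) → ∀ u → length u ≡ n → T (f u)
forAllWords-elim zero    f h []      refl = h
forAllWords-elim (suc n) f h (s ∷ u) refl = forAllWords-elim n (λ u → f (s ∷ u)) (forAllSym-elim (λ s → forAllWords n λ u → f (s ∷ u)) h s) u refl

shortCubeCheck : List Sym → Bool
shortCubeCheck v = hasShortCube 12 (letters v) ∨ not (hasShortCube 12 (morph v))

mismatch : List Sym → List Sym → ℕ → ℕ → Bool
mismatch v₁ v₂ r t = not (eqb (at (morph v₁) t) (at (morph v₂) (suc r + t)))

syncCheck : List Sym → List Sym → Bool
syncCheck v₁ v₂ = allBelow 11 λ r → anyBelow 13 (mismatch v₁ v₂ r)

opaque
  shortCubeCheck-ok : T (forAllWords 4 shortCubeCheck)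
  shortCubeCheck-ok = tt

  syncCheck-ok : T (forAllWords 2 λ v₁ → forAllWords 2 (syncCheck v₁))
  syncCheck-ok = tt

shortCube-reflect : ∀ v → length v ≡ 4 → T (hasShortCube 12 (letters v)) ⊎ ¬ T (hasShortCube 12 (morph v))
shortCube-reflect v |v|≡4 with to T-∨ (forAllWords-elim 4 shortCubeCheck shortCubeCheck-ok v |v|≡4)
... | inj₁ inLetters = inj₁ inLetters
... | inj₂ noneInImage = inj₂ (not-T noneInImage)
  where
  not-T : ∀ {b} → T (not b) → ¬ T b
  not-T {O} _ ()

synchronised : ∀ v₁ v₂ → length v₁ ≡ 2 → length v₂ ≡ 2 → ∀ {r} → r < 11 →
               ∃ λ t → t < 13 × at (morph v₁) t ≢ at (morph v₂) (suc r + t)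
synchronised v₁ v₂ |v₁|≡2 |v₂|≡2 {r} r<11
  with anyBelow-sound 13 (mismatch v₁ v₂ r) (allBelow-sound 11 (λ r → anyBelow 13 (mismatch v₁ v₂ r)) (forAllWords-elim 2 (syncCheck v₁)
         (forAllWords-elim 2 (λ v → forAllWords 2 (syncCheck v)) syncCheck-ok v₁ |v₁|≡2) v₂ |v₂|≡2) r r<11)
... | t , t<13 , differ = t , t<13 , different differ
  where
  different : ∀ {a b} → T (not (eqb a b)) → a ≢ b
  different {I} () refl
  different {O} () refl

roundUp : ∀ i → ∃ λ k → ∃ λ r → r < 12 × k * 12 ≡ i + r
roundUp zero = 0 , 0 , z<s , refl
roundUp (suc i) with roundUp i
... | k , zero  , _      , k≡ = suc k , 11 , ≤-refl , trans (cong (12 +_) k≡) (shift i)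
  where
  shift : ∀ i → 12 + (i + 0) ≡ suc i + 11
  shift = solve-∀
... | k , suc r , r+1<12 , k≡ = k , r , <-trans (n<1+n r) r+1<12 , trans k≡ (+-suc i r)

shortCube-window : ∀ {i p n} → p < 12 → 4 ≤ n → i + (p + (p + p)) ≤ n * 12 →
                   ∃ λ b → ∃ λ i' → b + 4 ≤ n × i ≡ b * 12 + i' × i' + (p + (p + p)) ≤ 4 * 12
shortCube-window {i} {p} {n} p<12 4≤n fits with i / 12 + 4 ≤? n
... | yes room = i / 12 , i % 12 , room , trans (m≡m%n+[m/n]*n i 12) (+-comm (i % 12) _) ,
                 ≤-trans (+-mono-≤ (≤-pred (m%n<n i 12)) (+-mono-≤ p≤11 (+-mono-≤ p≤11 p≤11))) (≤ᵇ⇒≤ 44 48 tt)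
  where
  p≤11 : p ≤ 11
  p≤11 = ≤-pred p<12
... | no  noRoom = b , i' , ≤-reflexive b+4≡n , i≡ , i'-fits
  where
  -- the cube starts in one of the last four blocks, so take b = n - 4
  b : ℕ
  b = n ∸ 4
  b+4≡n : b + 4 ≡ n
  b+4≡n = m∸n+n≡m 4≤n
  b<i/12 : b < i / 12
  b<i/12 = +-cancelʳ-≤ 4 (suc b) (i / 12) (subst (λ m → suc m ≤ i / 12 + 4) (sym b+4≡n) (≰⇒> noRoom))
  b*12≤i : b * 12 ≤ i
  b*12≤i = ≤-trans (*-monoˡ-≤ 12 (<⇒≤ b<i/12))
                   (subst (i / 12 * 12 ≤_) (sym (m≡m%n+[m/n]*n i 12)) (m≤n+m (i / 12 * 12) (i % 12)))
  i' : ℕ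
  i' = proj₁ (m≤n⇒∃[o]m+o≡n b*12≤i)
  i≡ : i ≡ b * 12 + i'
  i≡ = sym (proj₂ (m≤n⇒∃[o]m+o≡n b*12≤i))
  i'-fits : i' + (p + (p + p)) ≤ 4 * 12
  i'-fits = +-cancelˡ-≤ (b * 12) _ _ (subst₂ _≤_ (trans (cong (_+ (p + (p + p))) i≡) (+-assoc (b * 12) i' _))
              (trans (cong (_* 12) (sym b+4≡n)) (*-distribʳ-+ 12 b 4)) fits)

-- Case p < 12 is impossible: the cube lies in the image of four consecutive letters v
-- of u, so by the first finite check the letters of v, a factor of letters u, contain a cube.
short-period : ∀ u → 4 ≤ length u → NoCubeAt (letters u) → ∀ {i p} → CubeAt (morph u) i p → 12 ≤ p
short-period u 4≤n noCube {i} {p} c with p <? 12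
... | no  p≮12 = ≮⇒≥ p≮12
... | yes p<12 with shortCube-window p<12 4≤n (subst (i + (p + (p + p)) ≤_) (morph-length u) (CubeAt.fits c))
...   | b , i' , b+4≤n , i≡ , i'-fits with split3 u b 4 b+4≤n
...     | a , v , rest , u≡ , |a|≡b , |v|≡4 with shortCube-reflect v |v|≡4
...       | inj₂ noShortCube = shortPeriodsExcluded 12 (morph v) noShortCube cubeInV
  where
  i≡' : i ≡ length (morph a) + i'
  i≡' = trans i≡ (cong (_+ i') (sym (trans (morph-length a) (cong (_* 12) |a|≡b))))
  cubeInV : CubeAt (morph v) i' p
  cubeInV = cubeAt-restrict (morph a) (morph v) (morph rest)
              (subst (i' + (p + (p + p)) ≤_) (sym (trans (morph-length v) (cong (_* 12) |v|≡4))) i'-fits)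
              (subst₂ (λ w j → CubeAt w j p) (trans (cong morph u≡) (trans (morph-++ a (v ++ rest)) (cong (morph a ++_) (morph-++ v rest)))) i≡' c)
...       | inj₁ shortCube with hasShortCube-sound 12 (letters v) shortCube
...         | j , q , cubeInV = contradiction (subst (λ w → CubeAt w (length (letters a) + j) q) (sym letters≡)
                                  (cubeAt-extend (letters a) (letters v) (letters rest) cubeInV)) (noCube _ q)
  where
  letters≡ : letters u ≡ letters a ++ letters v ++ letters rest
  letters≡ = trans (cong letters u≡) (trans (map-++ proj₁ a (v ++ rest)) (cong (letters a ++_) (map-++ proj₁ v rest)))

aligned-fits : ∀ {i r k m n} → r < 12 → k * 12 ≡ i + r → i + (m * 12 + (m * 12 + m * 12)) ≤ n * 12 →
               k + (m + (m + m)) ≤ n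
aligned-fits {i} {r} {k} {m} {n} r<12 k≡ fits = ≤-pred (*-cancelʳ-< 12 _ _ bound)
  where
  open ≤-Reasoning
  M : ℕ
  M = m * 12 + (m * 12 + m * 12)
  distrib : ∀ k m → (k + (m + (m + m))) * 12 ≡ k * 12 + (m * 12 + (m * 12 + m * 12))
  distrib = solve-∀
  swap : ∀ i M → i + 12 + M ≡ i + M + 12
  swap = solve-∀
  bound : (k + (m + (m + m))) * 12 < suc n * 12
  bound = begin-strict
    (k + (m + (m + m))) * 12 ≡⟨ trans (distrib k m) (cong (_+ M) k≡) ⟩
    i + r + M                <⟨ +-monoˡ-< M (+-monoʳ-< i r<12) ⟩
    i + 12 + M               ≡⟨ swap i M ⟩
    i + M + 12               ≤⟨ +-monoˡ-≤ 12 fits ⟩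
    n * 12 + 12              ≡⟨ +-comm (n * 12) 12 ⟩
    suc n * 12               ∎

aligned-pullback : ∀ u {i m k r} → r < 12 → k * 12 ≡ i + r → CubeAt (morph u) i (m * 12) → CubeAt (letters u) k m
aligned-pullback u {i} {m} {k} {r} r<12 k≡ (cube 12m>0 fits periodic) = cube (m>0 m 12m>0) fits' periodic'
  where
  m>0 : ∀ m → 0 < m * 12 → 0 < m
  m>0 (suc m) _ = z<s
  fitsU : k + (m + (m + m)) ≤ length u
  fitsU = aligned-fits {k = k} {m = m} r<12 k≡ (subst (i + (m * 12 + (m * 12 + m * 12)) ≤_) (morph-length u) fits)
  fits' : k + (m + (m + m)) ≤ length (letters u)
  fits' = subst (_ ≤_) (sym (length-map proj₁ u)) fitsU
  block-offset : ∀ t → (k + t) * 12 ≡ i + (r + t * 12)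
  block-offset t = trans (*-distribʳ-+ 12 k t) (trans (cong (_+ t * 12) k≡) (+-assoc i r (t * 12)))
  shifted-offset : ∀ t → i + m * 12 + (r + t * 12) ≡ (k + m + t) * 12
  shifted-offset t = trans (rearrange i r (m * 12) (t * 12)) (sym (trans (distrib k m t) (cong (λ x → x + m * 12 + t * 12) k≡)))
    where
    rearrange : ∀ i r M T → i + M + (r + T) ≡ i + r + M + T
    rearrange = solve-∀
    distrib : ∀ k m t → (k + m + t) * 12 ≡ k * 12 + m * 12 + t * 12
    distrib = solve-∀
  offset<2p : ∀ t → t < m + m → r + t * 12 < m * 12 + m * 12
  offset<2p t t<2m = ≤-trans (+-monoˡ-≤ (t * 12) r<12)
                             (≤-trans (*-monoˡ-≤ 12 t<2m) (≤-reflexive (*-distribʳ-+ 12 m m)))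
  periodic' : ∀ t → t < m + m → at (letters u) (k + t) ≡ at (letters u) (k + m + t)
  periodic' t t<2m with cube-inside fitsU t<2m
  ... | in₁ , in₂ = begin
    at (letters u) (k + t)                   ≡⟨ sym (morph-at-block u in₁) ⟩
    at (morph u) ((k + t) * 12)              ≡⟨ cong (at (morph u)) (block-offset t) ⟩
    at (morph u) (i + (r + t * 12))          ≡⟨ periodic (r + t * 12) (offset<2p t t<2m) ⟩
    at (morph u) (i + m * 12 + (r + t * 12)) ≡⟨ cong (at (morph u)) (shifted-offset t) ⟩
    at (morph u) ((k + m + t) * 12)          ≡⟨ morph-at-block u in₂ ⟩
    at (letters u) (k + m + t)               ∎
    where open ≡-Reasoning

unaligned-fits : ∀ {i r k p m s n} → r < 12 → k * 12 ≡ i + r → p ≡ suc s + m * 12 → 12 ≤ p →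
                 i + (p + (p + p)) ≤ n * 12 → k + 2 ≤ n × k + m + 2 ≤ n
unaligned-fits {i} {r} {k} {p} {m} {s} {n} r<12 k≡ p≡ 12≤p fits = first , second
  where
  open ≤-Reasoning
  first : k + 2 ≤ n
  first = *-cancelʳ-≤ (k + 2) n 12 (begin
    (k + 2) * 12       ≡⟨ trans (*-distribʳ-+ 12 k 2) (cong (_+ 24) k≡) ⟩
    i + r + 24         ≡⟨ +-assoc i r 24 ⟩
    i + (r + 24)       ≤⟨ +-monoʳ-≤ i (≤-trans (<⇒≤ (+-monoˡ-< 24 r<12)) (+-mono-≤ 12≤p (+-mono-≤ 12≤p 12≤p))) ⟩
    i + (p + (p + p))  ≤⟨ fits ⟩
    n * 12             ∎)
  distrib : ∀ k m → (k + m + 1) * 12 ≡ k * 12 + m * 12 + 12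
  distrib = solve-∀
  rearrange : ∀ i r M → i + r + M + 12 ≡ i + (r + (M + 12))
  rearrange = solve-∀
  reorder : ∀ M → 12 + (M + 12) ≡ M + (12 + 12)
  reorder = solve-∀
  m*12≤p : m * 12 ≤ p
  m*12≤p = subst (m * 12 ≤_) (sym p≡) (m≤n+m (m * 12) (suc s))
  second : k + m + 2 ≤ n
  second = subst (_≤ n) (sym (+-suc (k + m) 1)) (*-cancelʳ-< 12 (k + m + 1) n (begin-strict
    (k + m + 1) * 12         ≡⟨ trans (distrib k m) (cong (λ x → x + m * 12 + 12) k≡) ⟩
    i + r + m * 12 + 12      ≡⟨ rearrange i r (m * 12) ⟩
    i + (r + (m * 12 + 12))  <⟨ +-monoʳ-< i (+-monoˡ-< (m * 12 + 12) r<12) ⟩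
    i + (12 + (m * 12 + 12)) ≡⟨ cong (i +_) (reorder (m * 12)) ⟩
    i + (m * 12 + (12 + 12)) ≤⟨ +-monoʳ-≤ i (+-mono-≤ m*12≤p (+-mono-≤ 12≤p 12≤p)) ⟩
    i + (p + (p + p))        ≤⟨ fits ⟩
    n * 12                   ∎))

unaligned-offsets : ∀ {i r k p m s a₁ a₂} → k * 12 ≡ i + r → p ≡ suc s + m * 12 → a₁ ≡ k → a₂ ≡ k + m → ∀ t →
                    a₁ * 12 + t ≡ i + (r + t) × i + p + (r + t) ≡ a₂ * 12 + (suc s + t)
unaligned-offsets {i} {r} {k} {p} {m} {s} k≡ refl refl refl t =
  trans (cong (_+ t) k≡) (+-assoc i r t) ,
  trans (rearrange i r (m * 12) s t) (sym (cong (_+ (suc s + t)) (trans (*-distribʳ-+ 12 k m) (cong (_+ m * 12) k≡))))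
  where
  rearrange : ∀ i r M s t → i + (suc s + M) + (r + t) ≡ i + r + M + (suc s + t)
  rearrange = solve-∀

-- Case 12 ∤ p, p ≥ 12, p = s + 1 + 12m with s < 11: the two blocks v₁ from the
-- cube's first block boundary k reappear p positions later, that is, shifted by
-- s + 1 against the two blocks v₂ from block k + m — which the second finite check forbids.
shifted-blocks-impossible : ∀ u {i p k r m s} → CubeAt (morph u) i p → 12 ≤ p → r < 12 → k * 12 ≡ i + r →
  p ≡ suc s + m * 12 → s < 11 →
  (∃ λ a₁ → ∃ λ v₁ → ∃ λ b₁ → u ≡ a₁ ++ v₁ ++ b₁ × length a₁ ≡ k × length v₁ ≡ 2) →
  (∃ λ a₂ → ∃ λ v₂ → ∃ λ b₂ → u ≡ a₂ ++ v₂ ++ b₂ × length a₂ ≡ k + m × length v₂ ≡ 2) → ⊥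
shifted-blocks-impossible u {i} {p} {k} {r} {m} {s} (cube _ _ periodic) 12≤p r<12 k≡ p≡ s<11
  (a₁ , v₁ , b₁ , u≡₁ , |a₁|≡k , |v₁|≡2) (a₂ , v₂ , b₂ , u≡₂ , |a₂|≡k+m , |v₂|≡2)
  with synchronised v₁ v₂ |v₁|≡2 |v₂|≡2 s<11
... | t , t<13 , differ = differ (begin
  at (morph v₁) t                              ≡⟨ sym (morph-window u a₁ v₁ b₁ u≡₁ (subst (t <_) (sym (cong (_* 12) |v₁|≡2)) (≤-trans t<13 (≤ᵇ⇒≤ 13 24 tt)))) ⟩
  at (morph u) (length a₁ * 12 + t)            ≡⟨ cong (at (morph u)) (proj₁ offsets) ⟩
  at (morph u) (i + (r + t))                   ≡⟨ periodic (r + t) (≤-trans (s≤s (+-mono-≤ (≤-pred r<12) (≤-pred t<13))) (+-mono-≤ 12≤p 12≤p)) ⟩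
  at (morph u) (i + p + (r + t))               ≡⟨ cong (at (morph u)) (proj₂ offsets) ⟩
  at (morph u) (length a₂ * 12 + (suc s + t))  ≡⟨ morph-window u a₂ v₂ b₂ u≡₂ (subst (suc s + t <_) (sym (cong (_* 12) |v₂|≡2)) (s≤s (+-mono-≤ s<11 (≤-pred t<13)))) ⟩
  at (morph v₂) (suc s + t)                    ∎)
  where
  open ≡-Reasoning
  offsets : length a₁ * 12 + t ≡ i + (r + t) × i + p + (r + t) ≡ length a₂ * 12 + (suc s + t)
  offsets = unaligned-offsets {i} {r} {k} {p} {m} {s} k≡ p≡ |a₁|≡k |a₂|≡k+m t

unaligned-impossible : ∀ u {i p k r m s} → CubeAt (morph u) i p → 12 ≤ p → r < 12 → k * 12 ≡ i + r →
                       p ≡ suc s + m * 12 → s < 11 → ⊥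
unaligned-impossible u {i} {p} {k} {r} {m} {s} c 12≤p r<12 k≡ p≡ s<11 =
  shifted-blocks-impossible u c 12≤p r<12 k≡ p≡ s<11 (split3 u k 2 (proj₁ blocks-fit)) (split3 u (k + m) 2 (proj₂ blocks-fit))
  where
  blocks-fit : k + 2 ≤ length u × k + m + 2 ≤ length u
  blocks-fit = unaligned-fits {i} {r} {k} {p} {m} {s} r<12 k≡ p≡ 12≤p
                 (subst (i + (p + (p + p)) ≤_) (morph-length u) (CubeAt.fits c))

morph-preserves-cubefree : ∀ u → 4 ≤ length u → NoCubeAt (letters u) → NoCubeAt (morph u)
morph-preserves-cubefree u 4≤n noCube i p c with roundUp i | p % 12 | m≡m%n+[m/n]*n p 12 | m%n<n p 12
... | k , r , r<12 , k≡ | zero  | p≡ | _    =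
  noCube k (p / 12) (aligned-pullback u {i} {p / 12} {k} {r} r<12 k≡ (subst (CubeAt (morph u) i) p≡ c))
... | k , r , r<12 , k≡ | suc s | p≡ | s<12 =
  unaligned-impossible u {i} {p} {k} {r} {p / 12} {s} c (short-period u 4≤n noCube c) r<12 k≡ p≡ (≤-pred s<12)

embed : Word → Word → Word
embed Y c = morph (zip Y c)

zip-letters : ∀ (Y c : Word) → length c ≡ length Y → letters (zip Y c) ≡ Y
zip-letters []      []      _ = refl
zip-letters (a ∷ Y) (x ∷ c) e = cong (a ∷_) (zip-letters Y c (suc-injective e))

zip-length : ∀ (Y c : Word) → length c ≡ length Y → length (zip Y c) ≡ length Y
zip-length []      []      _ = refl
zip-length (a ∷ Y) (x ∷ c) e = cong suc (zip-length Y c (suc-injective e))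

embed-length : ∀ Y c → length c ≡ length Y → length (embed Y c) ≡ length Y * 12
embed-length Y c e = trans (morph-length (zip Y c)) (cong (_* 12) (zip-length Y c e))

embed-square-cubefree : ∀ Y c → length c ≡ length Y → 2 ≤ length Y → NoCubeAt (Y ++ Y) →
                        NoCubeAt (embed Y c ++ embed Y c)
embed-square-cubefree Y c e 2≤Y noCube =
  subst NoCubeAt (morph-++ u u) (morph-preserves-cubefree (u ++ u) 4≤uu (subst NoCubeAt (sym letters≡) noCube))
  where
  u : List Sym
  u = zip Y c
  letters≡ : letters (u ++ u) ≡ Y ++ Y
  letters≡ = trans (map-++ proj₁ u u) (cong₂ _++_ (zip-letters Y c e) (zip-letters Y c e))
  4≤uu : 4 ≤ length (u ++ u)
  4≤uu = subst (4 ≤_) (sym (trans (length-++ u) (cong₂ _+_ (zip-length Y c e) (zip-length Y c e)))) (+-mono-≤ 2≤Y 2≤Y)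

seed : ℕ → Word
seed zero    = O ∷ O ∷ I ∷ []
seed (suc k) = embed (seed k) (replicate (length (seed k)) O)

seed-length : ∀ k → 3 + k ≤ length (seed k)
seed-length zero    = ≤-refl
seed-length (suc k) = subst (3 + suc k ≤_) (sym (embed-length (seed k) _ (length-replicate (length (seed k)))))
                        (grows (seed-length k))
  where
  grows : ∀ {n L} → 3 + n ≤ L → suc (3 + n) ≤ L * 12
  grows {L = suc L} (s≤s 2+n≤L) = ≤-trans (+-monoʳ-≤ 2 2+n≤L) (+-mono-≤ (≤ᵇ⇒≤ 2 12 tt) (m≤m*n L 12))

seed-square-cubefree : ∀ k → NoCubeAt (seed k ++ seed k)
seed-square-cubefree zero i p c = <⇒≱ (≤ᵇ⇒≤ 7 12 tt) 12≤6
  where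
  -- 001001 has no cube of period < 12 (computed), but is too short for a longer one
  12≤6 : 12 ≤ 6
  12≤6 = ≤-trans (shortPeriodsExcluded 12 _ (λ ()) c) (≤-trans (m≤m+n p _) (≤-trans (m≤n+m _ i) (CubeAt.fits c)))
seed-square-cubefree (suc k) =
  embed-square-cubefree (seed k) _ (length-replicate _) (≤-trans (s≤s (s≤s z≤n)) (seed-length k)) (seed-square-cubefree k)

allWords : ℕ → List Word
allWords zero    = [] ∷ []
allWords (suc n) = map (I ∷_) (allWords n) ++ map (O ∷_) (allWords n)

allWords-length : ∀ n → All (λ c → length c ≡ n) (allWords n)
allWords-length zero    = refl ∷ []
allWords-length (suc n) = All.++⁺ (All.map⁺ (All.map (cong suc) (allWords-length n)))
                                  (All.map⁺ (All.map (cong suc) (allWords-length n)))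

allWords-count : ∀ n → length (allWords n) ≡ 2 ^ n
allWords-count zero    = refl
allWords-count (suc n) = begin
  length (map (I ∷_) (allWords n) ++ map (O ∷_) (allWords n))         ≡⟨ length-++ (map (I ∷_) (allWords n)) ⟩
  length (map (I ∷_) (allWords n)) + length (map (O ∷_) (allWords n)) ≡⟨ cong₂ _+_ (length-map _ (allWords n)) (length-map _ (allWords n)) ⟩
  length (allWords n) + length (allWords n)                           ≡⟨ cong₂ _+_ (allWords-count n) (allWords-count n) ⟩
  2 ^ n + 2 ^ n                                                       ≡⟨ cong (2 ^ n +_) (sym (+-identityʳ (2 ^ n))) ⟩
  2 ^ suc n                                                           ∎
  where open ≡-Reasoning

allWords-unique : ∀ n → Unique (allWords n)
allWords-unique zero    = [] ∷ []
allWords-unique (suc n) =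
  Unique.++⁺ (Unique.map⁺ ∷-injectiveʳ (allWords-unique n)) (Unique.map⁺ ∷-injectiveʳ (allWords-unique n)) disjoint
  where
  disjoint : ∀ {v} → ¬ (v ∈ map (I ∷_) (allWords n) × v ∈ map (O ∷_) (allWords n))
  disjoint (v∈I , v∈O) with ∈-map⁻ (I ∷_) v∈I | ∈-map⁻ (O ∷_) v∈O
  ... | _ , _ , v≡I∷ | _ , _ , v≡O∷ with trans (sym v≡I∷) v≡O∷
  ... | ()

choiceOf : Bool → Word → Bool
choiceOf O w = not (at w 4)
choiceOf I w = not (at w 1)

choiceOf-block : ∀ a c R → choiceOf a (block a c ++ R) ≡ c
choiceOf-block O O R = refl
choiceOf-block O I R = refl
choiceOf-block I O R = refl
choiceOf-block I I R = refl

drop-block : ∀ a c R → drop 12 (block a c ++ R) ≡ R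
drop-block O O R = refl
drop-block O I R = refl
drop-block I O R = refl
drop-block I I R = refl

decode : Word → Word → Word
decode []      w = []
decode (a ∷ Y) w = choiceOf a w ∷ decode Y (drop 12 w)

decode-embed : ∀ Y c R → length c ≡ length Y → decode Y (embed Y c ++ R) ≡ c
decode-embed []      []      R _ = refl
decode-embed (a ∷ Y) (x ∷ c) R e rewrite ++-assoc (block a x) (embed Y c) R =
  cong₂ _∷_ (choiceOf-block a x _) (trans (cong (decode Y) (drop-block a x _)) (decode-embed Y c R (suc-injective e)))

unique-map-retraction : ∀ {A B : Set} (f : A → B) (g : B → A) {xs} →
                        All (λ x → g (f x) ≡ x) xs → Unique xs → Unique (map f xs)
unique-map-retraction f g []           []             = []
unique-map-retraction f g (gfx ∷ gfxs) (x∉xs ∷ unique) = images-differ gfx x∉xs gfxs ∷ unique-map-retraction f g gfxs unique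
  where
  images-differ : ∀ {x ys} → g (f x) ≡ x → All (λ y → x ≢ y) ys → All (λ y → g (f y) ≡ y) ys → All (λ y → f x ≢ y) (map f ys)
  images-differ gfx []           []           = []
  images-differ gfx (x≢y ∷ x≢ys) (gfy ∷ gfys) = (λ fx≡fy → x≢y (trans (sym gfx) (trans (cong g fx≡fy) gfy))) ∷ images-differ gfx x≢ys gfys

cubefree-squares : ∀ Y → 2 ≤ length Y → NoCubeAt (Y ++ Y) →
                   ∃ λ (ws : List Word) → Unique ws × All (CubefreeSquareOfLength (length Y * 24)) ws × length ws ≡ 2 ^ length Y
cubefree-squares Y 2≤Y noCube =
  map square (allWords m) , unique , All.map⁺ (All.map good (allWords-length m)) , trans (length-map square (allWords m)) (allWords-count m)
  where
  m : ℕ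
  m = length Y
  square : Word → Word
  square c = embed Y c ++ embed Y c
  double : ∀ m → m * 12 + m * 12 ≡ m * 24
  double = solve-∀
  good : ∀ {c} → length c ≡ m → CubefreeSquareOfLength (m * 24) (square c)
  good {c} e = length-square , (embed Y c , nonempty-embed , refl) , cubefree (embed-square-cubefree Y c e 2≤Y noCube)
    where
    length-square : length (square c) ≡ m * 24
    length-square = trans (length-++ (embed Y c)) (trans (cong₂ _+_ (embed-length Y c e) (embed-length Y c e)) (double m))
    nonempty-embed : embed Y c ≢ []
    nonempty-embed e≡[] = <⇒≢ (m<n⇒m<n*o 12 (≤-trans (s≤s z≤n) 2≤Y)) (trans (sym (cong length e≡[])) (embed-length Y c e))
  unique : Unique (map square (allWords m))
  unique = unique-map-retraction square (decode Y) (All.map (λ {c} e → decode-embed Y c (embed Y c) e) (allWords-length m)) (allWords-unique m)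

power-bound : ∀ a b c k → a ^ k ≤ b ^ k * c → ∀ m → a ^ (m * k) ≤ b ^ (m * k) * c ^ m
power-bound a b c k base zero    = ≤-refl
power-bound a b c k base (suc m) = begin
  a ^ (k + m * k)                   ≡⟨ ^-distribˡ-+-* a k (m * k) ⟩
  a ^ k * a ^ (m * k)               ≤⟨ *-mono-≤ base (power-bound a b c k base m) ⟩
  b ^ k * c * (b ^ (m * k) * c ^ m) ≡⟨ regroup (b ^ k) (b ^ (m * k)) c (c ^ m) ⟩
  b ^ k * b ^ (m * k) * (c * c ^ m) ≡⟨ cong (_* (c * c ^ m)) (sym (^-distribˡ-+-* b k (m * k))) ⟩
  b ^ (k + m * k) * (c * c ^ m)     ∎
  where
  open ≤-Reasoning
  regroup : ∀ x y c d → x * c * (y * d) ≡ x * y * (c * d)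
  regroup = solve-∀

proposition10 : ∃ λ p → ∃ λ q → 0 < q × q < p ×
                  ((N : ℕ) → ∃ λ n → N ≤ n × 0 < n ×
                    ∃ λ (ws : List Word) → Unique ws × All (CubefreeSquareOfLength n) ws
                      × p ^ n ≤ q ^ n * length ws)
proposition10 = 36 , 35 , z<s , ≤-refl , λ N →
  length (seed N) * 24 , N≤n N , m<n⇒m<n*o 24 (0<m N) ,
  squares-counted (length (seed N)) (cubefree-squares (seed N) (≤-trans (s≤s (s≤s z≤n)) (seed-length N)) (seed-square-cubefree N))
  where
  0<m : ∀ N → 0 < length (seed N)
  0<m N = ≤-trans (s≤s z≤n) (seed-length N)
  N≤n : ∀ N → N ≤ length (seed N) * 24
  N≤n N = ≤-trans (m≤n+m N 3) (≤-trans (seed-length N) (m≤m*n (length (seed N)) 24))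
  -- 2 ≥ (36/35)^24, so 2^m squares number at least (36/35)^(24m)
  squares-counted : ∀ m → (∃ λ (ws : List Word) → Unique ws × All (CubefreeSquareOfLength (m * 24)) ws × length ws ≡ 2 ^ m) →
                    ∃ λ (ws : List Word) → Unique ws × All (CubefreeSquareOfLength (m * 24)) ws × 36 ^ (m * 24) ≤ 35 ^ (m * 24) * length ws
  squares-counted m (ws , unique , squares , count) =
    ws , unique , squares , subst (λ x → 36 ^ (m * 24) ≤ 35 ^ (m * 24) * x) (sym count) (power-bound 36 35 2 24 (≤ᵇ⇒≤ _ _ tt) m)
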